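{- For every integer $n\geq 2$, $$\mathrm{R}_{3,2}(K_{1,2},K_{1,n},K_{1,n})=n+1.$$
   Context: $K_{1,n}$ denotes the star with one center and $n$ leaves. For positive integers $r\ge s$ and graphs $G_1,\dots,G_r$, the set-coloring Ramsey number $\mathrm{R}_{r,s}(G_1,\dots,G_r)$ is the least $N\in\mathbb{N}$ such that for every coloring $\chi:E(K_N)\to\binom{[r]}{s}$ (each edge receives a set of $s$ distinct colors from $[r]$) there exist $i\in[r]$ and a copy of $G_i$ in $K_N$ with $i\in\chi(e)$ for every edge $e$ of this copy. -}

module Defs where

open import Data.Nat using (ℕ; _<_)
open import Data.Fin using (Fin; zero; suc)
open import Data.Fin.Subset using (Subset; _∈_; ∣_∣)
open import Data.Product using (Σ; _×_; ∃)
open import Relation.Binary.PropositionalEquality using (_≡_; _≢_)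
open import Relation.Nullary using (¬_)
open import Function.Definitions using (Injective)

-- A set-coloring of E(K_N) with s-subsets of [r] = Fin r:
-- each unordered pair {u,v} (u ≢ v) receives a subset of Fin r of size s,
-- symmetric in u and v. (Values on the diagonal u ≡ v are irrelevant.)
record SetColoring (r s N : ℕ) : Set where
  field
    col  : Fin N → Fin N → Subset r
    size : ∀ u v → u ≢ v → ∣ col u v ∣ ≡ s
    symm : ∀ u v → col u v ≡ col v u
open SetColoring public

MonoStar : ∀ {r s N} → SetColoring r s N → Fin r → ℕ → Set
MonoStar {N = N} χ i m =
  Σ (Fin N) λ c → Σ (Fin m → Fin N) λ leaf →
    Injective _≡_ _≡_ leaf × (∀ j → leaf j ≢ c) × (∀ j → i ∈ col χ c (leaf j))

StarArrows : (r s : ℕ) → (Fin r → ℕ) → ℕ → Set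
StarArrows r s m N = (χ : SetColoring r s N) → ∃ λ i → MonoStar χ i (m i)

IsStarSetRamsey : (r s : ℕ) → (Fin r → ℕ) → ℕ → Set
IsStarSetRamsey r s m N = StarArrows r s m N × (∀ M → M < N → ¬ StarArrows r s m M)

sizes-2nn : ℕ → Fin 3 → ℕ
sizes-2nn n zero = 2
sizes-2nn n (suc zero) = n
sizes-2nn n (suc (suc zero)) = n

-- Lower bound: colour every edge {1, 2}. Colour 0 is then never used, and a star
-- K_{1,n} needs n + 1 vertices.
-- Upper bound: in K_{n+1} look at the n edges at one vertex. Unless all of them
-- contain colour 1 or all contain colour 2, one edge misses 1 and one misses 2.
-- Both contain colour 0, and they differ because a 2-subset of {0, 1, 2} misses
-- only one colour: a K_{1,2} in colour 0.
module Submission where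

open import Defs
open import Data.Nat using (ℕ; _≤_; _<_; suc; s≤s)
open import Data.Nat.Properties using (<⇒≱; suc-injective)
open import Data.Fin using (Fin; zero; suc)
open import Data.Fin.Patterns using (0F; 1F; 2F)
open import Data.Fin.Properties using (all?; ¬∀⟶∃¬; injective⇒≤; punchOut-injective)
  renaming (suc-injective to Fin-suc-injective)
open import Data.Fin.Subset using (Subset; _∈_; _∉_; ∣_∣; inside; outside)
open import Data.Fin.Subset.Properties using (_∈?_; ∣p∣≡n⇒p≡⊤; ∈⊤)
open import Data.Vec using (_∷_; []; here; there)
open import Data.Product using (∃; _,_)
open import Data.Sum using (_⊎_; inj₁; inj₂)
open import Function.Base using (_∘_)
open import Function.Definitions using (Injective)
open import Relation.Binary.PropositionalEquality using (_≡_; _≢_; refl; sym; cong; ≢-sym; subst)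
open import Relation.Nullary using (¬_; yes; no; contradiction)

∣p∣≡n⇒x∈p : ∀ {n} {p : Subset n} {x} → ∣ p ∣ ≡ n → x ∈ p
∣p∣≡n⇒x∈p {x = x} ∣p∣≡n = subst (x ∈_) (sym (∣p∣≡n⇒p≡⊤ ∣p∣≡n)) ∈⊤

∉-unique : ∀ {n} {p : Subset (suc n)} {x y} → ∣ p ∣ ≡ n → x ∉ p → y ∉ p → x ≡ y
∉-unique {x = zero}  {zero}  _ _ _ = refl
∉-unique {p = inside ∷ _} {x = zero} _ x∉p _ = contradiction here x∉p
∉-unique {p = inside ∷ _} {y = zero} _ _ y∉p = contradiction here y∉p
∉-unique {p = outside ∷ _} {x = zero} {suc _} ∣q∣≡n _ y∉p =
  contradiction (there (∣p∣≡n⇒x∈p ∣q∣≡n)) y∉p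
∉-unique {p = outside ∷ _} {x = suc _} ∣q∣≡n x∉p _ =
  contradiction (there (∣p∣≡n⇒x∈p ∣q∣≡n)) x∉p
∉-unique {suc n} {inside ∷ _} {suc _} {suc _} ∣p∣≡n x∉p y∉p =
  cong suc (∉-unique (suc-injective ∣p∣≡n) (x∉p ∘ there) (y∉p ∘ there))

∉⇒others∈ : ∀ {n} {p : Subset (suc n)} {x y} → ∣ p ∣ ≡ n → x ∉ p → x ≢ y → y ∈ p
∉⇒others∈ {p = p} {y = y} ∣p∣≡n x∉p x≢y with y ∈? p
... | yes y∈p = y∈p
... | no  y∉p = contradiction (∉-unique ∣p∣≡n x∉p y∉p) x≢y

MonoStar⇒< : ∀ {r s N m} (χ : SetColoring r s N) i → MonoStar χ i m → m < N
MonoStar⇒< {N = suc _} _ _ (_ , leaf , leaf-injective , leaf≢c , _) =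
  s≤s (injective⇒≤ λ {j} {k} eq →
    leaf-injective (punchOut-injective (≢-sym (leaf≢c j)) (≢-sym (leaf≢c k)) eq))

constantColoring : ∀ {r s} N (p : Subset r) → ∣ p ∣ ≡ s → SetColoring r s N
constantColoring N p ∣p∣≡s = record
  { col  = λ _ _ → p
  ; size = λ _ _ _ → ∣p∣≡s
  ; symm = λ _ _ → refl
  }

cherry : ∀ {r s N} (χ : SetColoring r s N) {i} c {u v} →
         u ≢ v → u ≢ c → v ≢ c → i ∈ col χ c u → i ∈ col χ c v → MonoStar χ i 2
cherry {N = N} χ c {u} {v} u≢v u≢c v≢c i∈cu i∈cv =
  c , leaf , leaf-injective , leaf≢c , colours
  where
  leaf : Fin 2 → Fin N
  leaf 0F = u
  leaf 1F = v

  leaf-injective : Injective _≡_ _≡_ leaf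
  leaf-injective {0F} {0F} _  = refl
  leaf-injective {0F} {1F} eq = contradiction eq u≢v
  leaf-injective {1F} {0F} eq = contradiction (sym eq) u≢v
  leaf-injective {1F} {1F} _  = refl

  leaf≢c : ∀ j → leaf j ≢ c
  leaf≢c 0F = u≢c
  leaf≢c 1F = v≢c

  colours : ∀ j → _ ∈ col χ c (leaf j)
  colours 0F = i∈cu
  colours 1F = i∈cv

star-at-0-or-gap : ∀ {r s n} (χ : SetColoring r s (suc n)) i →
                 MonoStar χ i n ⊎ ∃ λ j → i ∉ col χ zero (suc j)
star-at-0-or-gap {n = n} χ i with all? (λ j → i ∈? col χ zero (suc j))
... | yes all = inj₁ (zero , suc , Fin-suc-injective , (λ _ ()) , all)
... | no ¬all = inj₂ (¬∀⟶∃¬ n _ (λ j → i ∈? col χ zero (suc j)) ¬all)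

arrows-suc-n : ∀ n → StarArrows 3 2 (sizes-2nn n) (suc n)
arrows-suc-n n χ with star-at-0-or-gap χ 1F | star-at-0-or-gap χ 2F
... | inj₁ star | _         = 1F , star
... | inj₂ _    | inj₁ star = 2F , star
... | inj₂ (j₁ , 1∉p₁) | inj₂ (j₂ , 2∉p₂) =
  0F , cherry χ zero leaves-distinct (λ ()) (λ ())
                 (∉⇒others∈ (size₂ j₁) 1∉p₁ λ ()) (∉⇒others∈ (size₂ j₂) 2∉p₂ λ ())
  where
  size₂ : ∀ j → ∣ col χ zero (suc j) ∣ ≡ 2
  size₂ j = size χ zero (suc j) λ ()

  leaves-distinct : suc j₁ ≢ suc j₂
  leaves-distinct refl with ∉-unique (size₂ j₁) 1∉p₁ 2∉p₂
  ... | ()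

coloring₁₂ : ∀ N → SetColoring 3 2 N
coloring₁₂ N = constantColoring N (outside ∷ inside ∷ inside ∷ []) refl

¬arrows-≤n : ∀ n M → M < suc n → ¬ StarArrows 3 2 (sizes-2nn n) M
¬arrows-≤n n M (s≤s M≤n) arrows with arrows (coloring₁₂ M)
... | 0F , _ , _ , _ , _ , colours = contradiction (colours 0F) λ ()
... | 1F , star = <⇒≱ (MonoStar⇒< (coloring₁₂ M) 1F star) M≤n
... | 2F , star = <⇒≱ (MonoStar⇒< (coloring₁₂ M) 2F star) M≤n

proposition2p10 : (n : ℕ) → 2 ≤ n → IsStarSetRamsey 3 2 (sizes-2nn n) (suc n)
proposition2p10 n _ = arrows-suc-n n , ¬arrows-≤n n
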